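{- The following claim (Proposition 4 of Balabanov, Chiang and Jiang, 2014) is unsound: "Let $X=\{x_1,\dots,x_n\}$, $Y=\{y_1,\dots,y_m\}$, and consider the closed prenex DQBF $\forall x_1\ldots\forall x_n\,\exists y_1(S_1)\ldots\exists y_m(S_m):(\phi_A\vee\phi_B)$, where $\phi_A$ refers to variables $X_A\subseteq X$ and $Y_A\subseteq Y$ and $\phi_B$ refers to variables $X_B\subseteq X$ and $Y_B\subseteq Y$. Then it is logically equivalent to $\forall\vec{x}_c\bigl((\forall\vec{x}_a\,\exists y_{a_1}(S_{a_1}\cap X_A)\ldots\exists y_{a_p}(S_{a_p}\cap X_A):\phi_A)\vee(\forall\vec{x}_b\,\exists y_{b_1}(S_{b_1}\cap X_B)\ldots\exists y_{b_q}(S_{b_q}\cap X_B):\phi_B)\bigr)$, where $\vec{x}_c$ are the variables in $X_A\cap X_B$, $\vec{x}_a$ those in $X_A\setminus X_B$, $\vec{x}_b$ those in $X_B\setminus X_A$, $y_{a_i}\in Y_A$, and $y_{b_j}\in Y_B$." Namely, there are formulas of this form for which the two DQBFs are not even equisatisfiable.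
   Context: Semantics of DQBFs (closed prenex and non-prenex): a DQBF in which every existential variable $y$ carries a dependency set $D_y$ of universal variables is satisfiable iff there are functions $s_y$ for the existential variables, each depending only on the universal variables in $D_y$ that are in scope (in particular constant if none are), such that replacing every existential variable by its function makes the quantifier-free matrix a tautology over the universal variables. Two DQBFs are equisatisfiable if both are satisfiable or both are unsatisfiable. $\exists y(\emptyset)$ means $y$ depends on no variable. -}

module Defs where

open import Data.Nat using (ℕ)
open import Data.Bool using (Bool; true; false; not; _∧_; _∨_)
open import Data.Fin using (Fin)
open import Data.Fin.Subset using (Subset; _∈_; _∩_; _∪_; ⁅_⁆) renaming (⊥ to ∅)
open import Data.Product using (Σ; _×_)
open import Data.Sum using (_⊎_)
open import Relation.Nullary using (¬_)
open import Relation.Binary.PropositionalEquality using (_≡_)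

data Formula (n m : ℕ) : Set where
  ⊤f ⊥f : Formula n m
  xv    : Fin n → Formula n m
  yv    : Fin m → Formula n m
  ¬f_   : Formula n m → Formula n m
  _∧f_  : Formula n m → Formula n m → Formula n m
  _∨f_  : Formula n m → Formula n m → Formula n m

UAssign : ℕ → Set
UAssign n = Fin n → Bool

EAssign : ℕ → Set
EAssign m = Fin m → Bool

eval : ∀ {n m} → Formula n m → UAssign n → EAssign m → Bool
eval ⊤f        a b = true
eval ⊥f        a b = false
eval (xv i)    a b = a i
eval (yv j)    a b = b j
eval (¬f φ)    a b = not (eval φ a b)
eval (φ ∧f ψ)  a b = eval φ a b ∧ eval ψ a b
eval (φ ∨f ψ)  a b = eval φ a b ∨ eval ψ a b

uvars : ∀ {n m} → Formula n m → Subset n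
uvars ⊤f       = ∅
uvars ⊥f       = ∅
uvars (xv i)   = ⁅ i ⁆
uvars (yv j)   = ∅
uvars (¬f φ)   = uvars φ
uvars (φ ∧f ψ) = uvars φ ∪ uvars ψ
uvars (φ ∨f ψ) = uvars φ ∪ uvars ψ

AgreeOn : ∀ {n} → Subset n → UAssign n → UAssign n → Set
AgreeOn D a a' = ∀ i → i ∈ D → a i ≡ a' i

DependsOnlyOn : ∀ {n} → Subset n → (UAssign n → Bool) → Set
DependsOnlyOn D f = ∀ a a' → AgreeOn D a a' → f a ≡ f a'

SkolemFamily : ∀ {n} (m : ℕ) → (Fin m → Subset n) → Set
SkolemFamily {n} m D =
  Σ (Fin m → UAssign n → Bool) λ s → ∀ j → DependsOnlyOn (D j) (s j)

-- Satisfiability of the closed prenex DQBF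
--   ∀x₁…∀xₙ ∃y₁(S₁)…∃yₘ(Sₘ) : φ.
PrenexSat : ∀ {n m} → (Fin m → Subset n) → Formula n m → Set
PrenexSat {n} {m} S φ =
  Σ (SkolemFamily m S) λ sk →
    ∀ (a : UAssign n) → eval φ a (λ j → Σ.proj₁ sk j a) ≡ true
  where open Data.Product

-- Satisfiability of the non-prenex DQBF
--   ∀x⃗_c ((∀x⃗_a ∃y_{a₁}(S_{a₁} ∩ X_A)… : φ_A) ∨ (∀x⃗_b ∃y_{b₁}(S_{b₁} ∩ X_B)… : φ_B))
-- with X_A = uvars φA, X_B = uvars φB, x⃗_c = X_A ∩ X_B.  The existential
-- variables of the two disjuncts are separate bound copies and get separate
-- Skolem functions (sA, sB).  Skolem functions for existential variables
-- not occurring in the respective disjunct are irrelevant.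
SplitSat : ∀ {n m} → (Fin m → Subset n) → Formula n m → Formula n m → Set
SplitSat {n} {m} S φA φB =
  Σ (SkolemFamily m (λ j → S j ∩ uvars φA)) λ skA →
  Σ (SkolemFamily m (λ j → S j ∩ uvars φB)) λ skB →
    ∀ (c : UAssign n) →
      (∀ a → AgreeOn (uvars φA ∩ uvars φB) c a →
          eval φA a (λ j → Σ.proj₁ skA j a) ≡ true)
      ⊎
      (∀ a → AgreeOn (uvars φA ∩ uvars φB) c a →
          eval φB a (λ j → Σ.proj₁ skB j a) ≡ true)
  where open Data.Product

Equisat : Set → Set → Set
Equisat P Q = (P × Q) ⊎ (¬ P × ¬ Q)

-- Take one universal x and one existential y with empty dependency set, and
-- φ_A = y ∧ x, φ_B = ¬y ∧ ¬x. The prenex form asks for a constant y equal to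
-- x, which does not exist. In the split form x is shared by both disjuncts,
-- so it is fixed before choosing a disjunct; each disjunct binds its own copy
-- of y, and the constants y := true in φ_A and y := false in φ_B cover x = 1
-- and x = 0 respectively.
module Submission where

open import Defs
open import Data.Bool using (Bool; true; false)
open import Data.Empty using (⊥; ⊥-elim)
open import Data.Fin using (Fin; zero)
open import Data.Fin.Subset using (Subset; _∩_) renaming (⊥ to ∅)
open import Data.Fin.Subset.Properties using (∉⊥)
open import Data.Product using (Σ; ∃-syntax; _,_)
open import Data.Sum using (_⊎_; inj₁; inj₂)
open import Data.Vec using (here)
open import Relation.Nullary using (¬_)
open import Relation.Binary.PropositionalEquality using (_≡_; refl; sym; trans)

¬Equisat-unsat-sat : ∀ {P Q : Set} → ¬ P → Q → ¬ Equisat P Q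
¬Equisat-unsat-sat ¬p q (inj₁ (p , _))  = ¬p p
¬Equisat-unsat-sat ¬p q (inj₂ (_ , ¬q)) = ¬q q

dependsOnly∅⇒constant : ∀ {n} {f : UAssign n → Bool} →
                        DependsOnlyOn ∅ f → ∀ a a' → f a ≡ f a'
dependsOnly∅⇒constant dep a a' = dep a a' λ _ i∈∅ → ⊥-elim (∉⊥ i∈∅)

constantFamily : ∀ {n m} (D : Fin m → Subset n) → (Fin m → Bool) → SkolemFamily m D
constantFamily D b = (λ j _ → b j) , λ _ _ _ _ → refl

noDeps : Fin 1 → Subset 1
noDeps _ = ∅

y⇔x y⇔x-A y⇔x-B : Formula 1 1
y⇔x-A = yv zero ∧f xv zero
y⇔x-B = (¬f yv zero) ∧f (¬f xv zero)
y⇔x = y⇔x-A ∨f y⇔x-B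

prenex-unsat : ¬ PrenexSat noDeps y⇔x
prenex-unsat ((s , dep) , sat) =
  contradict (dependsOnly∅⇒constant (dep zero) one zer) (sat one) (sat zer)
  where
  one zer : UAssign 1
  one _ = true
  zer _ = false

  contradict : ∀ {u v} → u ≡ v → eval y⇔x one (λ _ → u) ≡ true
             → eval y⇔x zer (λ _ → v) ≡ true → ⊥
  contradict {true}  refl _  ()
  contradict {false} refl () _

split-sat : SplitSat noDeps y⇔x-A y⇔x-B
split-sat = constantFamily _ (λ _ → true) , constantFamily _ (λ _ → false) , byShared
  where
  shared : Subset 1
  shared = uvars y⇔x-A ∩ uvars y⇔x-B

  byShared : ∀ c →
    (∀ a → AgreeOn shared c a → eval y⇔x-A a (λ _ → true) ≡ true) ⊎
    (∀ a → AgreeOn shared c a → eval y⇔x-B a (λ _ → false) ≡ true)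
  byShared c with c zero in cx
  ... | true  = inj₁ λ a agree → holds a (trans (sym (agree zero here)) cx)
    where holds : ∀ (a : UAssign 1) → a zero ≡ true → eval y⇔x-A a (λ _ → true) ≡ true
          holds a ax rewrite ax = refl
  ... | false = inj₂ λ a agree → holds a (trans (sym (agree zero here)) cx)
    where holds : ∀ (a : UAssign 1) → a zero ≡ false → eval y⇔x-B a (λ _ → false) ≡ true
          holds a ax rewrite ax = refl

lemma2 : ∃[ n ] ∃[ m ] Σ (Fin m → Subset n) λ S →
             Σ (Formula n m) λ φA → Σ (Formula n m) λ φB →
               ¬ Equisat (PrenexSat S (φA ∨f φB)) (SplitSat S φA φB)
lemma2 = 1 , 1 , noDeps , y⇔x-A , y⇔x-B , ¬Equisat-unsat-sat prenex-unsat split-sat
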